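{- Two players alternately toss a fair coin (independent tosses), each starting with $0$ dollars and gaining one dollar on Heads and two dollars on Tails; the first whose capital is $\ge n$ wins. Then for every $n\ge1$ the probability that the player who moves first wins is $\frac12(1+a(n))$, where $a$ is the sequence defined by $a(1)=1$, $a(2)=\tfrac12$, $a(3)=\tfrac58$, $a(4)=\tfrac{15}{32}$ and, for $n\ge5$, $$a(n)=\frac{(3n-1)(n-3)}{2n(3n-7)}a(n-1)+\frac{21n^2-67n+62}{16n(3n-7)}a(n-2)+\frac{6n^2-17n+2}{16n(3n-7)}a(n-3)-\frac{(n-4)(3n-4)}{16n(3n-7)}a(n-4).$$ -}

module Defs where

open import Data.Bool using (Bool; true; false; not; if_then_else_)
open import Data.Nat using (ℕ; zero; suc; _+_; _*_; _∸_; _^_; _≤ᵇ_)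
open import Data.List using (List; []; _∷_; map; _++_; length; filter)
open import Data.Integer using (+_)
open import Data.Rational using (ℚ; 0ℚ; _/_) renaming (_+_ to _+ℚ_; _*_ to _*ℚ_; _-_ to _-ℚ_)
open import Relation.Nullary.Decidable using (T?)

-- Division of naturals into ℚ; the value for denominator 0 is an unused
-- junk value (all denominators used below are nonzero).
_/ℚ_ : ℕ → ℕ → ℚ
m /ℚ zero    = 0ℚ
m /ℚ (suc d) = (+ m) / (suc d)

-- A toss is a Bool: true = Heads (+1 dollar),
-- false = Tails (+2 dollars).  State: target n, capital of the player about
-- to toss, capital of the other player, and whether the player about to toss
-- is the first player.  Returns true iff the first player wins.
-- (On an exhausted toss list it returns false; never reached for sequences
-- of length 2n, since the game ends after at most 2n - 1 tosses.)
go : ℕ → ℕ → ℕ → Bool → List Bool → Bool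
go n mine theirs moverIsFirst []       = false
go n mine theirs moverIsFirst (b ∷ bs) =
  let new = mine + (if b then 1 else 2) in
  if n ≤ᵇ new then moverIsFirst
  else go n theirs new (not moverIsFirst) bs

firstWins : ℕ → List Bool → Bool
firstWins n tosses = go n 0 0 true tosses

allSeqs : ℕ → List (List Bool)
allSeqs zero    = [] ∷ []
allSeqs (suc k) = map (true ∷_) (allSeqs k) ++ map (false ∷_) (allSeqs k)

probFirstWins : ℕ → ℚ
probFirstWins n =
  length (filter (λ s → T? (firstWins n s)) (allSeqs (2 * n))) /ℚ (2 ^ (2 * n))

-- The sequence a(n); a(0) is an unused junk value.
a : ℕ → ℚ
a zero = 0ℚ
a (suc zero) = 1 /ℚ 1
a (suc (suc zero)) = 1 /ℚ 2
a (suc (suc (suc zero))) = 5 /ℚ 8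
a (suc (suc (suc (suc zero)))) = 15 /ℚ 32
a (suc (suc (suc (suc (suc k))))) =
      (((3 * n ∸ 1) * (n ∸ 3)) /ℚ (2 * n * (3 * n ∸ 7))) *ℚ a (suc (suc (suc (suc k))))
    +ℚ (((21 * n * n + 62) ∸ 67 * n) /ℚ (16 * n * (3 * n ∸ 7))) *ℚ a (suc (suc (suc k)))
    +ℚ (((6 * n * n + 2) ∸ 17 * n) /ℚ (16 * n * (3 * n ∸ 7))) *ℚ a (suc (suc k))
    -ℚ (((n ∸ 4) * (3 * n ∸ 4)) /ℚ (16 * n * (3 * n ∸ 7))) *ℚ a (suc k)
  where
  n : ℕ
  n = suc (suc (suc (suc (suc k))))

module Submission where

-- Write hit k r for the probability that a capital growing by 1 or 2 per
-- toss first reaches r after exactly k tosses, and tie r s = Σₖ hit k r · hit k s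
-- for the probability that two independent players need equally many
-- tosses to reach r and s.
--
-- Conditioning on a full round of tosses shows, by induction
--     on the number of available tosses, that the winning chances of the
--     mover from the positions (m, t) and (t, m) add up to
--     1 + tie (n - m) (n - t) (mover-advantage).  At the start position this
--     says P(first player wins) = ½ (1 + tie n n).
-- (2) The recurrence.  For fixed k, r ↦ hit k r satisfies two linear
--     recurrences with polynomial coefficients (hit-rec₃, hit-rec₂).  A
--     creative-telescoping certificate G, verified by the ring solver, turns
--     them into the recurrence of a for the diagonal tie n n; the initial
--     values agree, so a n = tie n n (a≡tie).

open import Defs
open import Data.Nat using (ℕ; _≤_)
open import Data.Rational using (ℚ; ½; 1ℚ; _+_; _*_)
open import Relation.Binary.PropositionalEquality using (_≡_)

open import Data.Bool using (Bool; true; false; not; if_then_else_; T)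
import Data.Integer as ℤ
import Data.Integer.Properties as ℤP
open import Data.List using (List; []; _∷_; map; _++_; length; filter)
import Data.List.Properties as ListP
open import Data.Nat as ℕ using (zero; suc; _∸_; z≤n; s≤s; _<_)
import Data.Nat.Properties as ℕP
open import Data.Rational using (0ℚ; _-_; -_; _/_; toℚᵘ)
import Data.Rational.Properties as ℚP
open import Data.Rational.Solver using (module +-*-Solver)
import Data.Rational.Unnormalised as ℚᵘ
import Data.Rational.Unnormalised.Properties as ℚᵘP
open import Relation.Binary.PropositionalEquality using (refl; sym; trans; cong; cong₂; subst; module ≡-Reasoning)
open import Relation.Nullary.Decidable using (T?)
open import Data.Empty using (⊥; ⊥-elim)
open import Data.Nat.Tactic.RingSolver using (solve-∀)
open +-*-Solver using (solve; _:=_; _:+_; _:*_; _:-_; :-_; con; Polynomial)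

-- Natural numbers as rationals, written as 1 + (1 + … + 0) so that the
-- successor structure of an argument is visible to the ring solver.
ι : ℕ → ℚ
ι zero    = 0ℚ
ι (suc n) = 1ℚ + ι n

ι-+ : ∀ a b → ι (a ℕ.+ b) ≡ ι a + ι b
ι-+ zero    b = sym (ℚP.+-identityˡ (ι b))
ι-+ (suc a) b = trans (cong (λ z → 1ℚ + z) (ι-+ a b)) (sym (ℚP.+-assoc 1ℚ (ι a) (ι b)))

ι-* : ∀ a b → ι (a ℕ.* b) ≡ ι a * ι b
ι-* zero    b = sym (ℚP.*-zeroˡ (ι b))
ι-* (suc a) b = begin
  ι (b ℕ.+ a ℕ.* b)    ≡⟨ ι-+ b (a ℕ.* b) ⟩
  ι b + ι (a ℕ.* b)    ≡⟨ cong (ι b +_) (ι-* a b) ⟩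
  ι b + ι a * ι b      ≡⟨ solve 2 (λ A B → B :+ A :* B := (con 1ℚ :+ A) :* B) refl (ι a) (ι b) ⟩
  (1ℚ + ι a) * ι b     ∎
  where open ≡-Reasoning

ι-∸ : ∀ a b → b ≤ a → ι (a ∸ b) ≡ ι a - ι b
ι-∸ a b b≤a = begin
  ι (a ∸ b)                ≡⟨ solve 2 (λ X B → X := (X :+ B) :- B) refl (ι (a ∸ b)) (ι b) ⟩
  ι (a ∸ b) + ι b - ι b    ≡⟨ cong (_- ι b) (sym (ι-+ (a ∸ b) b)) ⟩
  ι (a ∸ b ℕ.+ b) - ι b    ≡⟨ cong (λ z → ι z - ι b) (ℕP.m∸n+n≡m b≤a) ⟩
  ι a - ι b                ∎
  where open ≡-Reasoning

-- ι agrees with the library's fractions m / 1, which lets the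
-- (normalising) rational arithmetic be compared through ℚᵘ.
toℚᵘ-fraction : ∀ m d → toℚᵘ (ℤ.+ m / suc d) ℚᵘ.≃ ℚᵘ.mkℚᵘ (ℤ.+ m) d
toℚᵘ-fraction m d = ℚP.toℚᵘ-fromℚᵘ (ℚᵘ.mkℚᵘ (ℤ.+ m) d)

ι-fraction : ∀ m → ι m ≡ ℤ.+ m / 1
ι-fraction zero    = refl
ι-fraction (suc m) = trans (cong (λ z → 1ℚ + z) (ι-fraction m)) (ℚP.toℚᵘ-injective (begin
  toℚᵘ (1ℚ + ℤ.+ m / 1)                      ≈⟨ ℚP.toℚᵘ-homo-+ 1ℚ (ℤ.+ m / 1) ⟩
  toℚᵘ 1ℚ ℚᵘ.+ toℚᵘ (ℤ.+ m / 1)              ≈⟨ ℚᵘP.+-cong (toℚᵘ-fraction 1 0) (toℚᵘ-fraction m 0) ⟩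
  ℚᵘ.mkℚᵘ (ℤ.+ 1) 0 ℚᵘ.+ ℚᵘ.mkℚᵘ (ℤ.+ m) 0  ≈⟨ ℚᵘ.*≡* (cong (λ z → ((ℤ.+ 1) ℤ.+ z) ℤ.* (ℤ.+ 1)) (ℤP.*-identityʳ (ℤ.+ m))) ⟩
  ℚᵘ.mkℚᵘ (ℤ.+ suc m) 0                      ≈⟨ ℚᵘP.≃-sym (toℚᵘ-fraction (suc m) 0) ⟩
  toℚᵘ (ℤ.+ suc m / 1)                       ∎))
  where open ℚᵘP.≃-Reasoning

fraction-cancel : ∀ x d → (ℤ.+ x / suc d) * (ℤ.+ suc d / 1) ≡ ℤ.+ x / 1
fraction-cancel x d = ℚP.toℚᵘ-injective (begin
  toℚᵘ ((ℤ.+ x / suc d) * (ℤ.+ suc d / 1))        ≈⟨ ℚP.toℚᵘ-homo-* (ℤ.+ x / suc d) (ℤ.+ suc d / 1) ⟩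
  toℚᵘ (ℤ.+ x / suc d) ℚᵘ.* toℚᵘ (ℤ.+ suc d / 1)  ≈⟨ ℚᵘP.*-cong (toℚᵘ-fraction x d) (toℚᵘ-fraction (suc d) 0) ⟩
  ℚᵘ.mkℚᵘ (ℤ.+ x) d ℚᵘ.* ℚᵘ.mkℚᵘ (ℤ.+ suc d) 0    ≈⟨ ℚᵘ.*≡* cross ⟩
  ℚᵘ.mkℚᵘ (ℤ.+ x) 0                               ≈⟨ ℚᵘP.≃-sym (toℚᵘ-fraction x 0) ⟩
  toℚᵘ (ℤ.+ x / 1)                                ∎)
  where
  open ℚᵘP.≃-Reasoning
  cross : ((ℤ.+ x) ℤ.* (ℤ.+ suc d)) ℤ.* (ℤ.+ 1) ≡ (ℤ.+ x) ℤ.* (ℤ.+ suc (d ℕ.* 1))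
  cross = trans (ℤP.*-identityʳ _) (cong (λ z → (ℤ.+ x) ℤ.* (ℤ.+ suc z)) (sym (ℕP.*-identityʳ d)))

/ℚ-*-ι : ∀ x d → 0 < d → (x /ℚ d) * ι d ≡ ι x
/ℚ-*-ι x (suc d) _ = begin
  (ℤ.+ x / suc d) * ι (suc d)        ≡⟨ cong ((ℤ.+ x / suc d) *_) (ι-fraction (suc d)) ⟩
  (ℤ.+ x / suc d) * (ℤ.+ suc d / 1)  ≡⟨ fraction-cancel x d ⟩
  ℤ.+ x / 1                          ≡⟨ sym (ι-fraction x) ⟩
  ι x                                ∎
  where open ≡-Reasoning

sumTo : ℕ → (ℕ → ℚ) → ℚ
sumTo zero    f = 0ℚ
sumTo (suc M) f = sumTo M f + f M

sumTo-zero : ∀ M f → (∀ k → f k ≡ 0ℚ) → sumTo M f ≡ 0ℚ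
sumTo-zero zero    f f≡0 = refl
sumTo-zero (suc M) f f≡0 = cong₂ _+_ (sumTo-zero M f f≡0) (f≡0 M)

sumTo-shift : ∀ M f → sumTo (suc M) f ≡ f 0 + sumTo M (λ k → f (suc k))
sumTo-shift zero    f = trans (ℚP.+-identityˡ (f 0)) (sym (ℚP.+-identityʳ (f 0)))
sumTo-shift (suc M) f = trans (cong (_+ f (suc M)) (sumTo-shift M f)) (ℚP.+-assoc (f 0) _ (f (suc M)))

sumTo-averages : ∀ M (f g h l : ℕ → ℚ) →
  sumTo M (λ k → (½ * (f k + g k)) * (½ * (h k + l k)))
    ≡ ½ * ½ * (sumTo M (λ k → f k * h k) + sumTo M (λ k → f k * l k) + sumTo M (λ k → g k * h k) + sumTo M (λ k → g k * l k))
sumTo-averages zero    f g h l = refl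
sumTo-averages (suc M) f g h l = trans (cong (_+ (½ * (f M + g M)) * (½ * (h M + l M))) (sumTo-averages M f g h l))
  (solve 8 (λ A B C D x y z w → con ½ :* con ½ :* (A :+ B :+ C :+ D) :+ (con ½ :* (x :+ y)) :* (con ½ :* (z :+ w))
              := con ½ :* con ½ :* ((A :+ x :* z) :+ (B :+ x :* w) :+ (C :+ y :* z) :+ (D :+ y :* w))) refl
     (sumTo M (λ k → f k * h k)) (sumTo M (λ k → f k * l k)) (sumTo M (λ k → g k * h k)) (sumTo M (λ k → g k * l k)) (f M) (g M) (h M) (l M))

sumTo-linear₅ : ∀ M c₀ c₁ c₂ c₃ c₄ (f₀ f₁ f₂ f₃ f₄ : ℕ → ℚ) →
  sumTo M (λ k → c₀ * f₀ k + c₁ * f₁ k + c₂ * f₂ k + c₃ * f₃ k + c₄ * f₄ k)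
    ≡ c₀ * sumTo M f₀ + c₁ * sumTo M f₁ + c₂ * sumTo M f₂ + c₃ * sumTo M f₃ + c₄ * sumTo M f₄
sumTo-linear₅ zero    c₀ c₁ c₂ c₃ c₄ f₀ f₁ f₂ f₃ f₄ =
  solve 5 (λ c₀ c₁ c₂ c₃ c₄ → con 0ℚ := c₀ :* con 0ℚ :+ c₁ :* con 0ℚ :+ c₂ :* con 0ℚ :+ c₃ :* con 0ℚ :+ c₄ :* con 0ℚ) refl c₀ c₁ c₂ c₃ c₄
sumTo-linear₅ (suc M) c₀ c₁ c₂ c₃ c₄ f₀ f₁ f₂ f₃ f₄ =
  trans (cong (_+ (c₀ * f₀ M + c₁ * f₁ M + c₂ * f₂ M + c₃ * f₃ M + c₄ * f₄ M)) (sumTo-linear₅ M c₀ c₁ c₂ c₃ c₄ f₀ f₁ f₂ f₃ f₄))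
    (solve 15 (λ c₀ c₁ c₂ c₃ c₄ s₀ s₁ s₂ s₃ s₄ t₀ t₁ t₂ t₃ t₄ →
        (c₀ :* s₀ :+ c₁ :* s₁ :+ c₂ :* s₂ :+ c₃ :* s₃ :+ c₄ :* s₄) :+ (c₀ :* t₀ :+ c₁ :* t₁ :+ c₂ :* t₂ :+ c₃ :* t₃ :+ c₄ :* t₄)
        := c₀ :* (s₀ :+ t₀) :+ c₁ :* (s₁ :+ t₁) :+ c₂ :* (s₂ :+ t₂) :+ c₃ :* (s₃ :+ t₃) :+ c₄ :* (s₄ :+ t₄)) refl
      c₀ c₁ c₂ c₃ c₄ (sumTo M f₀) (sumTo M f₁) (sumTo M f₂) (sumTo M f₃) (sumTo M f₄) (f₀ M) (f₁ M) (f₂ M) (f₃ M) (f₄ M))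

telescope : ∀ (f g : ℕ → ℚ) → (∀ k → f k + g k ≡ g (suc k)) → ∀ M → sumTo M f + g 0 ≡ g M
telescope f g step zero    = ℚP.+-identityˡ (g 0)
telescope f g step (suc M) = begin
  sumTo M f + f M + g 0    ≡⟨ solve 3 (λ S x y → S :+ x :+ y := x :+ (S :+ y)) refl (sumTo M f) (f M) (g 0) ⟩
  f M + (sumTo M f + g 0)  ≡⟨ cong (f M +_) (telescope f g step M) ⟩
  f M + g M                ≡⟨ step M ⟩
  g (suc M)                ∎
  where open ≡-Reasoning

-- hit k r is the probability that a capital growing by 1 or 2 per fair toss
-- first reaches at least r after exactly k tosses.
hit : ℕ → ℕ → ℚ
hit zero    zero    = 1ℚ
hit zero    (suc r) = 0ℚ
hit (suc k) zero    = 0ℚ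
hit (suc k) (suc r) = ½ * (hit k r + hit k (r ∸ 1))

-- A target r is always reached within r tosses.
hit-vanish : ∀ k r → r < k → hit k r ≡ 0ℚ
hit-vanish (suc k) zero    _         = refl
hit-vanish (suc k) (suc r) (s≤s r<k) =
  cong₂ (λ x y → ½ * (x + y)) (hit-vanish k r r<k) (hit-vanish k (r ∸ 1) (ℕP.≤-<-trans (ℕP.m∸n≤m r 1) r<k))

-- tie r s is the probability that two independent players need the same
-- number of tosses to reach the targets r and s.
tie : ℕ → ℕ → ℚ
tie r s = sumTo (suc r) (λ k → hit k r * hit k s)

-- Summing further than r adds only vanishing terms.
tie-extend : ∀ r s d → sumTo (d ℕ.+ suc r) (λ k → hit k r * hit k s) ≡ tie r s
tie-extend r s zero    = refl
tie-extend r s (suc d) = begin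
  sumTo (d ℕ.+ suc r) h + hit (d ℕ.+ suc r) r * hit (d ℕ.+ suc r) s
    ≡⟨ cong (λ z → sumTo (d ℕ.+ suc r) h + z * hit (d ℕ.+ suc r) s) (hit-vanish (d ℕ.+ suc r) r (ℕP.m≤n+m (suc r) d)) ⟩
  sumTo (d ℕ.+ suc r) h + 0ℚ * hit (d ℕ.+ suc r) s
    ≡⟨ solve 2 (λ S x → S :+ con 0ℚ :* x := S) refl (sumTo (d ℕ.+ suc r) h) (hit (d ℕ.+ suc r) s) ⟩
  sumTo (d ℕ.+ suc r) h
    ≡⟨ tie-extend r s d ⟩
  tie r s ∎
  where
  open ≡-Reasoning
  h : ℕ → ℚ
  h k = hit k r * hit k s

-- First-step analysis: both players toss once, each of the four outcomes
-- having probability ¼.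
tie-step : ∀ r s → 0 < r → 0 < s →
           tie r s ≡ ½ * ½ * (tie (r ∸ 1) (s ∸ 1) + tie (r ∸ 1) (s ∸ 2) + tie (r ∸ 2) (s ∸ 1) + tie (r ∸ 2) (s ∸ 2))
tie-step (suc r) (suc s) _ _ = begin
  tie (suc r) (suc s)
    ≡⟨ sumTo-shift (suc r) (λ k → hit k (suc r) * hit k (suc s)) ⟩
  0ℚ * hit 0 (suc s) + sumTo (suc r) (λ k → hit (suc k) (suc r) * hit (suc k) (suc s))
    ≡⟨ ℚP.+-identityˡ _ ⟩
  sumTo (suc r) (λ k → (½ * (hit k r + hit k (r ∸ 1))) * (½ * (hit k s + hit k (s ∸ 1))))
    ≡⟨ sumTo-averages (suc r) (λ k → hit k r) (λ k → hit k (r ∸ 1)) (λ k → hit k s) (λ k → hit k (s ∸ 1)) ⟩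
  ½ * ½ * (tie r s + tie r (s ∸ 1) + sumTo (suc r) (λ k → hit k (r ∸ 1) * hit k s) + sumTo (suc r) (λ k → hit k (r ∸ 1) * hit k (s ∸ 1)))
    ≡⟨ cong₂ (λ x y → ½ * ½ * (tie r s + tie r (s ∸ 1) + x + y)) (shorter r s) (shorter r (s ∸ 1)) ⟩
  ½ * ½ * (tie r s + tie r (s ∸ 1) + tie (r ∸ 1) s + tie (r ∸ 1) (s ∸ 1)) ∎
  where
  open ≡-Reasoning
  shorter : ∀ r y → sumTo (suc r) (λ k → hit k (r ∸ 1) * hit k y) ≡ tie (r ∸ 1) y
  shorter zero    y = refl
  shorter (suc r) y = tie-extend r y 1

-- A player with nothing left to reach cannot tie with one who still has to toss.
tie-zeroˡ : ∀ s → 0 < s → tie 0 s ≡ 0ℚ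
tie-zeroˡ (suc s) _ = refl

tie-zeroʳ : ∀ r → 0 < r → tie r 0 ≡ 0ℚ
tie-zeroʳ (suc r) _ = sumTo-zero (suc (suc r)) _ term≡0
  where
  term≡0 : ∀ k → hit k (suc r) * hit k 0 ≡ 0ℚ
  term≡0 zero    = refl
  term≡0 (suc k) = ℚP.*-zeroʳ (hit (suc k) (suc r))

count : (List Bool → Bool) → List (List Bool) → ℕ
count g xs = length (filter (λ s → T? (g s)) xs)

count-++ : ∀ g xs ys → count g (xs ++ ys) ≡ count g xs ℕ.+ count g ys
count-++ g xs ys = trans (cong length (ListP.filter-++ (λ s → T? (g s)) xs ys)) (ListP.length-++ (filter (λ s → T? (g s)) xs))

count-map : ∀ g b xs → count g (map (b ∷_) xs) ≡ count (λ s → g (b ∷ s)) xs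
count-map g b []       = refl
count-map g b (x ∷ xs) with g (b ∷ x)
... | true  = cong suc (count-map g b xs)
... | false = count-map g b xs

half^ : ℕ → ℚ
half^ zero    = 1ℚ
half^ (suc k) = ½ * half^ k

Pr : ℕ → (List Bool → Bool) → ℚ
Pr k g = ι (count g (allSeqs k)) * half^ k

Pr-step : ∀ k g → Pr (suc k) g ≡ ½ * (Pr k (λ s → g (true ∷ s)) + Pr k (λ s → g (false ∷ s)))
Pr-step k g = begin
  ι (count g (map (true ∷_) (allSeqs k) ++ map (false ∷_) (allSeqs k))) * (½ * half^ k)
    ≡⟨ cong (λ c → ι c * (½ * half^ k)) (count-++ g (map (true ∷_) (allSeqs k)) _) ⟩
  ι (count g (map (true ∷_) (allSeqs k)) ℕ.+ count g (map (false ∷_) (allSeqs k))) * (½ * half^ k)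
    ≡⟨ cong (λ c → ι c * (½ * half^ k)) (cong₂ ℕ._+_ (count-map g true (allSeqs k)) (count-map g false (allSeqs k))) ⟩
  ι (cᵗ ℕ.+ cᶠ) * (½ * half^ k)
    ≡⟨ cong (_* (½ * half^ k)) (ι-+ cᵗ cᶠ) ⟩
  (ι cᵗ + ι cᶠ) * (½ * half^ k)
    ≡⟨ solve 3 (λ x y h → (x :+ y) :* (con ½ :* h) := con ½ :* (x :* h :+ y :* h)) refl (ι cᵗ) (ι cᶠ) (half^ k) ⟩
  ½ * (ι cᵗ * half^ k + ι cᶠ * half^ k) ∎
  where
  open ≡-Reasoning
  cᵗ cᶠ : ℕ
  cᵗ = count (λ s → g (true ∷ s)) (allSeqs k)
  cᶠ = count (λ s → g (false ∷ s)) (allSeqs k)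

Pr-true : ∀ k → Pr k (λ _ → true) ≡ 1ℚ
Pr-true zero    = refl
Pr-true (suc k) = trans (Pr-step k _) (cong₂ (λ x y → ½ * (x + y)) (Pr-true k) (Pr-true k))

Pr-false : ∀ k → Pr k (λ _ → false) ≡ 0ℚ
Pr-false zero    = refl
Pr-false (suc k) = trans (Pr-step k _) (cong₂ (λ x y → ½ * (x + y)) (Pr-false k) (Pr-false k))

Pr-if : ∀ k c b (g : List Bool → Bool) → Pr k (λ s → if c then b else g s) ≡ (if c then Pr k (λ _ → b) else Pr k g)
Pr-if k true  b g = refl
Pr-if k false b g = refl

/ℚ-2^ : ∀ x k → x /ℚ (2 ℕ.^ k) ≡ ι x * half^ k
/ℚ-2^ x k = begin
  x /ℚ (2 ℕ.^ k)                                ≡⟨ solve 1 (λ y → y := y :* con 1ℚ) refl (x /ℚ (2 ℕ.^ k)) ⟩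
  (x /ℚ (2 ℕ.^ k)) * 1ℚ                         ≡⟨ cong ((x /ℚ (2 ℕ.^ k)) *_) (sym (ι-2^-half^ k)) ⟩
  (x /ℚ (2 ℕ.^ k)) * (ι (2 ℕ.^ k) * half^ k)    ≡⟨ sym (ℚP.*-assoc (x /ℚ (2 ℕ.^ k)) _ _) ⟩
  (x /ℚ (2 ℕ.^ k)) * ι (2 ℕ.^ k) * half^ k      ≡⟨ cong (_* half^ k) (/ℚ-*-ι x (2 ℕ.^ k) (ℕP.m^n>0 2 k)) ⟩
  ι x * half^ k                                 ∎
  where
  open ≡-Reasoning
  ι-2^-half^ : ∀ k → ι (2 ℕ.^ k) * half^ k ≡ 1ℚ
  ι-2^-half^ zero    = refl
  ι-2^-half^ (suc k) = begin
    ι (2 ℕ.* 2 ℕ.^ k) * (½ * half^ k)     ≡⟨ cong (_* (½ * half^ k)) (ι-* 2 (2 ℕ.^ k)) ⟩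
    ι 2 * ι (2 ℕ.^ k) * (½ * half^ k)     ≡⟨ solve 2 (λ x h → con (ι 2) :* x :* (con ½ :* h) := x :* h) refl (ι (2 ℕ.^ k)) (half^ k) ⟩
    ι (2 ℕ.^ k) * half^ k                 ≡⟨ ι-2^-half^ k ⟩
    1ℚ                                    ∎

-- The algebra of pairing up the four outcomes of a round played from the
-- positions (m, t) and (t, m).
paired-averages : ∀ a₁₁ a₁₂ a₂₁ a₂₂ b₁₁ b₁₂ b₂₁ b₂₂ e₁₁ e₁₂ e₂₁ e₂₂ →
  a₁₁ + b₁₁ ≡ 1ℚ + e₁₁ → a₁₂ + b₂₁ ≡ 1ℚ + e₁₂ → a₂₁ + b₁₂ ≡ 1ℚ + e₂₁ → a₂₂ + b₂₂ ≡ 1ℚ + e₂₂ →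
  ½ * (½ * (a₁₁ + a₁₂) + ½ * (a₂₁ + a₂₂)) + ½ * (½ * (b₁₁ + b₁₂) + ½ * (b₂₁ + b₂₂)) ≡ 1ℚ + ½ * ½ * (e₁₁ + e₁₂ + e₂₁ + e₂₂)
paired-averages a₁₁ a₁₂ a₂₁ a₂₂ b₁₁ b₁₂ b₂₁ b₂₂ e₁₁ e₁₂ e₂₁ e₂₂ h₁₁ h₁₂ h₂₁ h₂₂ = begin
  ½ * (½ * (a₁₁ + a₁₂) + ½ * (a₂₁ + a₂₂)) + ½ * (½ * (b₁₁ + b₁₂) + ½ * (b₂₁ + b₂₂))
    ≡⟨ solve 8 (λ a₁₁ a₁₂ a₂₁ a₂₂ b₁₁ b₁₂ b₂₁ b₂₂ →
         con ½ :* (con ½ :* (a₁₁ :+ a₁₂) :+ con ½ :* (a₂₁ :+ a₂₂)) :+ con ½ :* (con ½ :* (b₁₁ :+ b₁₂) :+ con ½ :* (b₂₁ :+ b₂₂))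
         := con ½ :* con ½ :* ((a₁₁ :+ b₁₁) :+ (a₁₂ :+ b₂₁) :+ (a₂₁ :+ b₁₂) :+ (a₂₂ :+ b₂₂))) refl a₁₁ a₁₂ a₂₁ a₂₂ b₁₁ b₁₂ b₂₁ b₂₂ ⟩
  ½ * ½ * ((a₁₁ + b₁₁) + (a₁₂ + b₂₁) + (a₂₁ + b₁₂) + (a₂₂ + b₂₂))
    ≡⟨ cong₂ (λ x y → ½ * ½ * (x + y)) (cong₂ _+_ (cong₂ _+_ h₁₁ h₁₂) h₂₁) h₂₂ ⟩
  ½ * ½ * ((1ℚ + e₁₁) + (1ℚ + e₁₂) + (1ℚ + e₂₁) + (1ℚ + e₂₂))
    ≡⟨ solve 4 (λ e₁₁ e₁₂ e₂₁ e₂₂ → con ½ :* con ½ :* ((con 1ℚ :+ e₁₁) :+ (con 1ℚ :+ e₁₂) :+ (con 1ℚ :+ e₂₁) :+ (con 1ℚ :+ e₂₂))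
         := con 1ℚ :+ con ½ :* con ½ :* (e₁₁ :+ e₁₂ :+ e₂₁ :+ e₂₂)) refl e₁₁ e₁₂ e₂₁ e₂₂ ⟩
  1ℚ + ½ * ½ * (e₁₁ + e₁₂ + e₂₁ + e₂₂) ∎
  where open ≡-Reasoning

module Game (n : ℕ) where

  δ : Bool → ℕ
  δ b = if b then 1 else 2

  -- V k m t: probability that the player about to toss, holding m against
  -- the opponent's t, is the first player and wins within k tosses.
  V : ℕ → ℕ → ℕ → ℚ
  V k m t = Pr k (go n m t true)

  afterToss : ℕ → ℕ → ℕ → Bool → Bool → ℚ
  afterToss k m t f b = Pr k (λ s → go n m t f (b ∷ s))

  afterToss-if : ∀ k m t f b → afterToss k m t f b ≡ (if n ℕ.≤ᵇ m ℕ.+ δ b then Pr k (λ _ → f) else Pr k (go n t (m ℕ.+ δ b) (not f)))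
  afterToss-if k m t f b = Pr-if k (n ℕ.≤ᵇ m ℕ.+ δ b) f (go n t (m ℕ.+ δ b) (not f))

  -- A state (m, t) with m, t < n is decided within
  -- k tosses when n + n ≤ k + (m + t) (up to one toss of slack): each toss
  -- raises a capital by at least 1, and this invariant passes to successors.
  below : ∀ x → (n ℕ.≤ᵇ x) ≡ false → x < n
  below x eq = ℕP.≰⇒> (λ n≤x → subst T eq (ℕP.≤⇒≤ᵇ n≤x))

  reached : ∀ x → (n ℕ.≤ᵇ x) ≡ true → n ≤ x
  reached x eq = ℕP.≤ᵇ⇒≤ n x (subst T (sym eq) _)

  δ≥1 : ∀ b → 1 ≤ δ b
  δ≥1 true  = s≤s z≤n
  δ≥1 false = s≤s z≤n

  -- With both capitals below n, a single toss cannot decide the game.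
  no-instant-end : ∀ {m t} → m < n → t < n → n ℕ.+ n ≤ suc (m ℕ.+ t) → ⊥
  no-instant-end {m} {t} m<n t<n b = ℕP.<-irrefl refl (ℕP.≤-trans sum<2n b)
    where
    sum<2n : suc (suc (m ℕ.+ t)) ≤ n ℕ.+ n
    sum<2n = subst (_≤ n ℕ.+ n) (cong suc (ℕP.+-suc m t)) (ℕP.+-mono-≤ m<n t<n)

  -- After a toss the roles swap and the mover's capital has grown by d ≥ 1.
  toss-budget : ∀ k m t d → 1 ≤ d → suc k ℕ.+ (m ℕ.+ t) ≤ k ℕ.+ (t ℕ.+ (m ℕ.+ d))
  toss-budget k m t d d≥1 = subst (_≤ k ℕ.+ (t ℕ.+ (m ℕ.+ d))) (reorder k m t)
    (ℕP.+-monoʳ-≤ k (ℕP.+-monoʳ-≤ t (ℕP.+-monoʳ-≤ m d≥1)))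
    where
    reorder : ∀ k m t → k ℕ.+ (t ℕ.+ (m ℕ.+ 1)) ≡ suc k ℕ.+ (m ℕ.+ t)
    reorder = solve-∀

  -- A game decided within k tosses always has a winner: when the mover is
  -- the second player, the first player wins with probability 1 - V k m t.
  complement : ∀ k m t → m < n → t < n → n ℕ.+ n ≤ suc k ℕ.+ (m ℕ.+ t) → Pr k (go n m t false) ≡ 1ℚ - V k m t
  complement zero    m t m<n t<n decided = ⊥-elim (no-instant-end m<n t<n decided)
  complement (suc k) m t m<n t<n decided = begin
    Pr (suc k) (go n m t false)
      ≡⟨ Pr-step k (go n m t false) ⟩
    ½ * (afterToss k m t false true + afterToss k m t false false)
      ≡⟨ cong₂ (λ x y → ½ * (x + y)) (toss true) (toss false) ⟩
    ½ * ((1ℚ - afterToss k m t true true) + (1ℚ - afterToss k m t true false))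
      ≡⟨ solve 2 (λ x y → con ½ :* ((con 1ℚ :- x) :+ (con 1ℚ :- y)) := con 1ℚ :- con ½ :* (x :+ y)) refl (afterToss k m t true true) (afterToss k m t true false) ⟩
    1ℚ - ½ * (afterToss k m t true true + afterToss k m t true false)
      ≡⟨ cong (λ x → 1ℚ - x) (sym (Pr-step k (go n m t true))) ⟩
    1ℚ - V (suc k) m t ∎
    where
    open ≡-Reasoning
    toss : ∀ b → afterToss k m t false b ≡ 1ℚ - afterToss k m t true b
    toss b rewrite afterToss-if k m t false b | afterToss-if k m t true b with n ℕ.≤ᵇ m ℕ.+ δ b in eq
    ... | true  = trans (Pr-false k) (cong (λ x → 1ℚ - x) (sym (Pr-true k)))
    ... | false = begin
      V k t (m ℕ.+ δ b)                                ≡⟨ solve 1 (λ x → x := con 1ℚ :- (con 1ℚ :- x)) refl (V k t (m ℕ.+ δ b)) ⟩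
      1ℚ - (1ℚ - V k t (m ℕ.+ δ b))                    ≡⟨ cong (λ x → 1ℚ - x) (sym (complement k t (m ℕ.+ δ b) t<n (below _ eq) budget)) ⟩
      1ℚ - Pr k (go n t (m ℕ.+ δ b) false)             ∎
      where
      budget : n ℕ.+ n ≤ suc k ℕ.+ (t ℕ.+ (m ℕ.+ δ b))
      budget = ℕP.≤-trans decided (toss-budget (suc k) m t (δ b) (δ≥1 b))

  reply : ℕ → ℕ → ℕ → Bool → ℚ
  reply k m t b = if n ℕ.≤ᵇ m ℕ.+ δ b then 1ℚ else 1ℚ - V k t (m ℕ.+ δ b)

  V-step : ∀ k m t → m < n → t < n → n ℕ.+ n ≤ suc k ℕ.+ (m ℕ.+ t) →
           V (suc k) m t ≡ ½ * (reply k m t true + reply k m t false)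
  V-step k m t m<n t<n decided = trans (Pr-step k (go n m t true)) (cong₂ (λ x y → ½ * (x + y)) (toss true) (toss false))
    where
    toss : ∀ b → afterToss k m t true b ≡ reply k m t b
    toss b rewrite afterToss-if k m t true b with n ℕ.≤ᵇ m ℕ.+ δ b in eq
    ... | true  = Pr-true k
    ... | false = complement k t (m ℕ.+ δ b) t<n (below _ eq)
                    (ℕP.≤-trans decided (ℕP.≤-trans (toss-budget k m t (δ b) (δ≥1 b)) (ℕP.n≤1+n _)))

  round : ℕ → ℕ → ℕ → Bool → Bool → ℚ
  round k m t b b' =
    if n ℕ.≤ᵇ m ℕ.+ δ b then 1ℚ else (if n ℕ.≤ᵇ t ℕ.+ δ b' then 0ℚ else V k (m ℕ.+ δ b) (t ℕ.+ δ b'))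

  reply-step : ∀ k m t b → m < n → t < n → n ℕ.+ n ≤ suc (suc k) ℕ.+ (m ℕ.+ t) →
               reply (suc k) m t b ≡ ½ * (round k m t b true + round k m t b false)
  reply-step k m t b m<n t<n decided with n ℕ.≤ᵇ m ℕ.+ δ b in eq
  ... | true  = refl
  ... | false = begin
    1ℚ - V (suc k) t m′
      ≡⟨ cong (λ x → 1ℚ - x) (V-step k t m′ t<n (below _ eq) (ℕP.≤-trans decided (toss-budget (suc k) m t (δ b) (δ≥1 b)))) ⟩
    1ℚ - ½ * (reply k t m′ true + reply k t m′ false)
      ≡⟨ cong₂ (λ x y → 1ℚ - ½ * (x + y)) (opponent true) (opponent false) ⟩
    1ℚ - ½ * ((1ℚ - x₁) + (1ℚ - x₂))
      ≡⟨ solve 2 (λ x₁ x₂ → con 1ℚ :- con ½ :* ((con 1ℚ :- x₁) :+ (con 1ℚ :- x₂)) := con ½ :* (x₁ :+ x₂)) refl x₁ x₂ ⟩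
    ½ * (x₁ + x₂) ∎
    where
    open ≡-Reasoning
    m′ : ℕ
    m′ = m ℕ.+ δ b
    lost : Bool → ℚ
    lost b′ = if n ℕ.≤ᵇ t ℕ.+ δ b′ then 0ℚ else V k m′ (t ℕ.+ δ b′)
    x₁ x₂ : ℚ
    x₁ = lost true
    x₂ = lost false
    opponent : ∀ b′ → reply k t m′ b′ ≡ 1ℚ - lost b′
    opponent b′ with n ℕ.≤ᵇ t ℕ.+ δ b′
    ... | true  = refl
    ... | false = refl

  V-two-steps : ∀ k m t → m < n → t < n → n ℕ.+ n ≤ suc (suc k) ℕ.+ (m ℕ.+ t) →
    V (suc (suc k)) m t ≡ ½ * (½ * (round k m t true true + round k m t true false) + ½ * (round k m t false true + round k m t false false))
  V-two-steps k m t m<n t<n decided = trans (V-step (suc k) m t m<n t<n decided)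
    (cong₂ (λ x y → ½ * (x + y)) (reply-step k m t true m<n t<n decided) (reply-step k m t false m<n t<n decided))

  round-budget : ∀ k m t d d′ → 1 ≤ d → 1 ≤ d′ → suc (suc k) ℕ.+ (m ℕ.+ t) ≤ k ℕ.+ ((m ℕ.+ d) ℕ.+ (t ℕ.+ d′))
  round-budget k m t d d′ d≥1 d′≥1 = subst (_≤ k ℕ.+ ((m ℕ.+ d) ℕ.+ (t ℕ.+ d′))) (reorder k m t)
    (ℕP.+-monoʳ-≤ k (ℕP.+-mono-≤ (ℕP.+-monoʳ-≤ m d≥1) (ℕP.+-monoʳ-≤ t d′≥1)))
    where
    reorder : ∀ k m t → k ℕ.+ ((m ℕ.+ 1) ℕ.+ (t ℕ.+ 1)) ≡ suc (suc k) ℕ.+ (m ℕ.+ t)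
    reorder = solve-∀

  MoverAdvantage : ℕ → Set
  MoverAdvantage k = ∀ m t → m < n → t < n → n ℕ.+ n ≤ k ℕ.+ (m ℕ.+ t) → V k m t + V k t m ≡ 1ℚ + tie (n ∸ m) (n ∸ t)

  round-pair : ∀ k → MoverAdvantage k → ∀ m t b b′ → n ℕ.+ n ≤ suc (suc k) ℕ.+ (m ℕ.+ t) →
               round k m t b b′ + round k t m b′ b ≡ 1ℚ + tie (n ∸ (m ℕ.+ δ b)) (n ∸ (t ℕ.+ δ b′))
  round-pair k IH m t b b′ decided with n ℕ.≤ᵇ m ℕ.+ δ b in e₁ | n ℕ.≤ᵇ t ℕ.+ δ b′ in e₂
  ... | true  | true  = sym (cong₂ (λ x y → 1ℚ + tie x y) (ℕP.m≤n⇒m∸n≡0 (reached _ e₁)) (ℕP.m≤n⇒m∸n≡0 (reached _ e₂)))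
  ... | true  | false = sym (trans (cong (λ x → 1ℚ + tie x (n ∸ (t ℕ.+ δ b′))) (ℕP.m≤n⇒m∸n≡0 (reached _ e₁)))
                                  (cong (λ z → 1ℚ + z) (tie-zeroˡ _ (ℕP.m<n⇒0<n∸m (below _ e₂)))))
  ... | false | true  = sym (trans (cong (λ y → 1ℚ + tie (n ∸ (m ℕ.+ δ b)) y) (ℕP.m≤n⇒m∸n≡0 (reached _ e₂)))
                                  (cong (λ z → 1ℚ + z) (tie-zeroʳ _ (ℕP.m<n⇒0<n∸m (below _ e₁)))))
  ... | false | false = IH (m ℕ.+ δ b) (t ℕ.+ δ b′) (below _ e₁) (below _ e₂)
                          (ℕP.≤-trans decided (round-budget k m t (δ b) (δ b′) (δ≥1 b) (δ≥1 b′)))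

  mover-advantage : ∀ k → MoverAdvantage k
  mover-advantage zero          m t m<n t<n decided = ⊥-elim (no-instant-end m<n t<n (ℕP.≤-trans decided (ℕP.n≤1+n _)))
  mover-advantage (suc zero)    m t m<n t<n decided = ⊥-elim (no-instant-end m<n t<n decided)
  mover-advantage (suc (suc k)) m t m<n t<n decided = begin
    V (suc (suc k)) m t + V (suc (suc k)) t m
      ≡⟨ cong₂ _+_ (V-two-steps k m t m<n t<n decided) (V-two-steps k t m t<n m<n decided′) ⟩
    ½ * (½ * (r m t true true + r m t true false) + ½ * (r m t false true + r m t false false))
      + ½ * (½ * (r t m true true + r t m true false) + ½ * (r t m false true + r t m false false))
      ≡⟨ paired-averages (r m t true true) (r m t true false) (r m t false true) (r m t false false)
                         (r t m true true) (r t m true false) (r t m false true) (r t m false false)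
                         (τ 1 1) (τ 1 2) (τ 2 1) (τ 2 2) (pair true true) (pair true false) (pair false true) (pair false false) ⟩
    1ℚ + ½ * ½ * (τ 1 1 + τ 1 2 + τ 2 1 + τ 2 2)
      ≡⟨ cong (λ z → 1ℚ + z) (sym first-round) ⟩
    1ℚ + tie (n ∸ m) (n ∸ t) ∎
    where
    open ≡-Reasoning
    r : ℕ → ℕ → Bool → Bool → ℚ
    r = round k
    τ : ℕ → ℕ → ℚ
    τ i j = tie (n ∸ (m ℕ.+ i)) (n ∸ (t ℕ.+ j))
    decided′ : n ℕ.+ n ≤ suc (suc k) ℕ.+ (t ℕ.+ m)
    decided′ = subst (λ z → n ℕ.+ n ≤ suc (suc k) ℕ.+ z) (ℕP.+-comm m t) decided
    pair : ∀ b b′ → r m t b b′ + r t m b′ b ≡ 1ℚ + τ (δ b) (δ b′)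
    pair b b′ = round-pair k (mover-advantage k) m t b b′ decided
    first-round : tie (n ∸ m) (n ∸ t) ≡ ½ * ½ * (τ 1 1 + τ 1 2 + τ 2 1 + τ 2 2)
    first-round rewrite sym (ℕP.∸-+-assoc n m 1) | sym (ℕP.∸-+-assoc n m 2) | sym (ℕP.∸-+-assoc n t 1) | sym (ℕP.∸-+-assoc n t 2) =
      tie-step (n ∸ m) (n ∸ t) (ℕP.m<n⇒0<n∸m m<n) (ℕP.m<n⇒0<n∸m t<n)

-- The certificate polynomials are written once, over an abstract signature
-- of ring operations, so that the same text denotes rational numbers
-- (ℚ-side) and expressions for the ring solver (Syntax).
record RingSyntax (A : Set) : Set where
  infixl 6 _⊕_ _⊖_
  infixl 7 _⊗_
  infix  8 ⊝_ #_
  infixr 9 1+_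
  field
    _⊕_ _⊗_ : A → A → A
    ⊝_      : A → A
    κ       : ℚ → A
  _⊖_ : A → A → A
  x ⊖ y = x ⊕ ⊝ y
  #_ : ℕ → A
  # c = κ (ℤ.+ c / 1)
  1+_ : A → A
  1+ x = # 1 ⊕ x

ℚ-syntax : RingSyntax ℚ
ℚ-syntax = record { _⊕_ = _+_ ; _⊗_ = _*_ ; ⊝_ = -_ ; κ = λ c → c }

polynomial-syntax : ∀ {m} → RingSyntax (Polynomial m)
polynomial-syntax = record { _⊕_ = _:+_ ; _⊗_ = _:*_ ; ⊝_ = :-_ ; κ = con }

module Certificate {A : Set} (R : RingSyntax A) where
  open RingSyntax R

  -- Recurrences in the target M at toss count K; hit-rec₃ and hit-rec₂ show
  -- that hit k annihilates them.
  rec₃ : A → A → A → A → A → A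
  rec₃ M K a b c =
      (# 2 ⊖ # 2 ⊗ K ⊕ # 2 ⊗ M) ⊗ a
    ⊕ (# 1 ⊖ # 5 ⊗ K ⊕ # 3 ⊗ M) ⊗ b
    ⊕ (⊝ # 1 ⊖ # 2 ⊗ K ⊕ M) ⊗ c

  rec₂ : A → A → A → A → A
  rec₂ M K a b =
      (K ⊕ # 3 ⊗ K ⊗ K ⊖ M ⊖ # 4 ⊗ M ⊗ K ⊕ M ⊗ M) ⊗ a
    ⊕ (# 3 ⊗ K ⊕ # 6 ⊗ K ⊗ K ⊖ M ⊖ # 5 ⊗ M ⊗ K ⊕ M ⊗ M) ⊗ b

  -- Coefficients of the recurrence c₀ e(N) + … + c₄ e(N - 4) = 0 for the
  -- diagonal e(N) = tie N N; up to the factor 16N(3N - 7) = c₀ they are the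
  -- weights in the definition of a.
  c₀ c₁ c₂ c₃ c₄ : A → A
  c₀ N = # 16 ⊗ N ⊗ (# 3 ⊗ N ⊖ # 7)
  c₁ N = ⊝ (# 8 ⊗ ((# 3 ⊗ N ⊖ # 1) ⊗ (N ⊖ # 3)))
  c₂ N = ⊝ (# 21 ⊗ N ⊗ N ⊕ # 62 ⊖ # 67 ⊗ N)
  c₃ N = ⊝ (# 6 ⊗ N ⊗ N ⊕ # 2 ⊖ # 17 ⊗ N)
  c₄ N = (N ⊖ # 4) ⊗ (# 3 ⊗ N ⊖ # 4)

  -- The summand of c₀ e(N) + … + c₄ e(N - 4) at one toss count, in terms of
  -- x₀ … x₄ = hit k N, …, hit k (N - 4).
  summand : A → A → A → A → A → A → A
  summand N x₀ x₁ x₂ x₃ x₄ = c₀ N ⊗ (x₀ ⊗ x₀) ⊕ c₁ N ⊗ (x₁ ⊗ x₁) ⊕ c₂ N ⊗ (x₂ ⊗ x₂) ⊕ c₃ N ⊗ (x₃ ⊗ x₃) ⊕ c₄ N ⊗ (x₄ ⊗ x₄)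

  -- The certificate: at toss count K, in terms of hit K N, hit K (N - 1),
  -- hit K (N - 2).  Its increment from K to K + 1 is the summand, up to the
  -- multiples μ₀, μ₁, μ₂, ν of the annihilating recurrences.
  G : A → A → A → A → A → A
  G N K a b c =
      (# 224 ⊗ K ⊕ # 400 ⊗ K ⊗ K ⊖ # 112 ⊗ N ⊖ # 448 ⊗ N ⊗ K) ⊗ (a ⊗ a)
    ⊕ (# 160 ⊕ # 816 ⊗ K ⊕ # 448 ⊗ K ⊗ K ⊖ # 304 ⊗ N ⊖ # 96 ⊗ N ⊗ K) ⊗ (a ⊗ b)
    ⊕ (# 160 ⊕ # 304 ⊗ K ⊕ # 112 ⊗ K ⊗ K) ⊗ (a ⊗ c)
    ⊕ (# 184 ⊖ # 32 ⊗ K ⊖ # 900 ⊗ K ⊗ K ⊖ # 228 ⊗ N ⊕ # 496 ⊗ N ⊗ K) ⊗ (b ⊗ b)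
    ⊕ (# 96 ⊖ # 144 ⊗ K ⊗ K) ⊗ (b ⊗ c)
    ⊕ (⊝ # 16 ⊖ # 32 ⊗ K ⊕ # 48 ⊗ K ⊗ K) ⊗ (c ⊗ c)

  μ₀ μ₁ μ₂ : A → A → A → A → A → A → A → A
  μ₀ N K x₀ x₁ x₂ x₃ x₄ =
      (⊝ # 80 ⊖ # 104 ⊗ K ⊖ # 8 ⊗ N) ⊗ x₀ ⊕ (⊝ # 38 ⊖ # 26 ⊗ K ⊕ # 10 ⊗ N) ⊗ x₁ ⊕ (# 89 ⊕ # 59 ⊗ K ⊖ # 21 ⊗ N) ⊗ x₂
    ⊕ (⊝ # 61 ⊕ # 5 ⊗ K ⊕ # 18 ⊗ N) ⊗ x₃ ⊕ (⊝ # 96 ⊖ # 38 ⊗ K ⊕ # 21 ⊗ N) ⊗ x₄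
  μ₁ N K x₀ x₁ x₂ x₃ x₄ =
      (# 82 ⊗ N ⊖ # 82 ⊗ K) ⊗ x₀ ⊕ (# 36 ⊖ # 107 ⊗ K ⊕ # 85 ⊗ N) ⊗ x₁ ⊕ (⊝ # 7 ⊖ # 45 ⊗ K) ⊗ x₂
    ⊕ (⊝ # 47 ⊖ # 67 ⊗ K ⊖ # 6 ⊗ N) ⊗ x₃ ⊕ (# 16 ⊕ # 2 ⊗ K ⊖ # 9 ⊗ N) ⊗ x₄
  μ₂ N K x₀ x₁ x₂ x₃ x₄ =
      (# 50 ⊗ K ⊖ # 50 ⊗ N) ⊗ x₀ ⊕ (# 76 ⊕ # 131 ⊗ K ⊖ # 53 ⊗ N) ⊗ x₁ ⊕ (# 65 ⊕ # 23 ⊗ K) ⊗ x₂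
    ⊕ (⊝ # 7 ⊖ # 23 ⊗ K) ⊗ x₃ ⊕ (⊝ # 4 ⊕ # 6 ⊗ K ⊕ # 3 ⊗ N) ⊗ x₄

  ν : A → A → A → A → A → A
  ν x₀ x₁ x₂ x₃ x₄ = # 64 ⊗ x₀ ⊖ # 224 ⊗ x₁ ⊖ # 96 ⊗ x₂ ⊕ # 32 ⊗ x₃ ⊕ # 8 ⊗ x₄

  -- The telescoping identity at N = J + 5, with the increment of the toss
  -- count already expanded by the recursion of hit.
  telescoping-lhs telescoping-rhs : A → A → A → A → A → A → A → A
  telescoping-lhs J K x₀ x₁ x₂ x₃ x₄ = summand N x₀ x₁ x₂ x₃ x₄ ⊕ G N K x₀ x₁ x₂
    where N = 1+ 1+ 1+ 1+ 1+ J
  telescoping-rhs J K x₀ x₁ x₂ x₃ x₄ =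
      G N (1+ K) (κ ½ ⊗ (x₁ ⊕ x₂)) (κ ½ ⊗ (x₂ ⊕ x₃)) (κ ½ ⊗ (x₃ ⊕ x₄))
    ⊕ (μ₀ N K x₀ x₁ x₂ x₃ x₄ ⊗ rec₃ (1+ 1+ 1+ 1+ J) K x₀ x₁ x₂
       ⊕ μ₁ N K x₀ x₁ x₂ x₃ x₄ ⊗ rec₃ (1+ 1+ 1+ J) K x₁ x₂ x₃
       ⊕ μ₂ N K x₀ x₁ x₂ x₃ x₄ ⊗ rec₃ (1+ 1+ J) K x₂ x₃ x₄)
    ⊕ ν x₀ x₁ x₂ x₃ x₄ ⊗ rec₂ N K x₀ x₁
    where N = 1+ 1+ 1+ 1+ 1+ J

module ℚ-side = Certificate ℚ-syntax
module Syntax {m : ℕ} = Certificate (polynomial-syntax {m})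

telescoping-identity : ∀ J K x₀ x₁ x₂ x₃ x₄ → ℚ-side.telescoping-lhs J K x₀ x₁ x₂ x₃ x₄ ≡ ℚ-side.telescoping-rhs J K x₀ x₁ x₂ x₃ x₄
telescoping-identity = solve 7 (λ J K x₀ x₁ x₂ x₃ x₄ → Syntax.telescoping-lhs J K x₀ x₁ x₂ x₃ x₄ := Syntax.telescoping-rhs J K x₀ x₁ x₂ x₃ x₄) refl

open RingSyntax ℚ-syntax using (#_)
open ℚ-side using (rec₃; rec₂; c₀; c₁; c₂; c₃; c₄; summand; G; μ₀; μ₁; μ₂; ν)

hit-zero-target : ∀ k → ι k * hit k 0 ≡ 0ℚ
hit-zero-target zero    = refl
hit-zero-target (suc k) = ℚP.*-zeroʳ (ι (suc k))

rec₃-zero : ∀ M K → rec₃ M K 0ℚ 0ℚ 0ℚ ≡ 0ℚ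
rec₃-zero = solve 2 (λ M K → Syntax.rec₃ M K (con 0ℚ) (con 0ℚ) (con 0ℚ) := con 0ℚ) refl

rec₂-zero : ∀ M K → rec₂ M K 0ℚ 0ℚ ≡ 0ℚ
rec₂-zero = solve 2 (λ M K → Syntax.rec₂ M K (con 0ℚ) (con 0ℚ) := con 0ℚ) refl

hit-rec₃ : ∀ k m → rec₃ (ι m) (ι k) (hit k (suc m)) (hit k m) (hit k (m ∸ 1)) ≡ 0ℚ
hit-rec₃ zero    zero          = refl
hit-rec₃ zero    (suc zero)    = refl
hit-rec₃ zero    (suc (suc j)) = rec₃-zero (ι (suc (suc j))) 0ℚ
hit-rec₃ (suc k) zero          = begin
  rec₃ 0ℚ (1ℚ + ι k) (½ * (hit k 0 + hit k 0)) 0ℚ 0ℚ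
    ≡⟨ solve 2 (λ K a → Syntax.rec₃ (con 0ℚ) (con 1ℚ :+ K) (con ½ :* (a :+ a)) (con 0ℚ) (con 0ℚ) := :- (con (# 2) :* (K :* a))) refl (ι k) (hit k 0) ⟩
  - (# 2 * (ι k * hit k 0))
    ≡⟨ cong (λ z → - (# 2 * z)) (hit-zero-target k) ⟩
  0ℚ ∎
  where open ≡-Reasoning
hit-rec₃ (suc k) (suc zero)    = begin
  rec₃ (1ℚ + 0ℚ) (1ℚ + ι k) (½ * (hit k 1 + hit k 0)) (½ * (hit k 0 + hit k 0)) 0ℚ
    ≡⟨ solve 3 (λ K a b → Syntax.rec₃ (con 1ℚ :+ con 0ℚ) (con 1ℚ :+ K) (con ½ :* (a :+ b)) (con ½ :* (b :+ b)) (con 0ℚ)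
                          := con ½ :* Syntax.rec₃ (con 0ℚ) K a b b :- con (# 5) :* con ½ :* (K :* b)) refl (ι k) (hit k 1) (hit k 0) ⟩
  ½ * rec₃ 0ℚ (ι k) (hit k 1) (hit k 0) (hit k 0) - # 5 * ½ * (ι k * hit k 0)
    ≡⟨ cong₂ (λ u v → ½ * u - # 5 * ½ * v) (hit-rec₃ k 0) (hit-zero-target k) ⟩
  0ℚ ∎
  where open ≡-Reasoning
hit-rec₃ (suc k) (suc (suc j)) = begin
  rec₃ (ι (suc (suc j))) (1ℚ + ι k) (½ * (x₀ + x₁)) (½ * (x₁ + x₂)) (½ * (x₂ + x₃))
    ≡⟨ solve 6 (λ J K x₀ x₁ x₂ x₃ → Syntax.rec₃ (con 1ℚ :+ (con 1ℚ :+ J)) (con 1ℚ :+ K) (con ½ :* (x₀ :+ x₁)) (con ½ :* (x₁ :+ x₂)) (con ½ :* (x₂ :+ x₃))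
                := con ½ :* Syntax.rec₃ (con 1ℚ :+ J) K x₀ x₁ x₂ :+ con ½ :* Syntax.rec₃ J K x₁ x₂ x₃) refl (ι j) (ι k) x₀ x₁ x₂ x₃ ⟩
  ½ * rec₃ (ι (suc j)) (ι k) x₀ x₁ x₂ + ½ * rec₃ (ι j) (ι k) x₁ x₂ x₃
    ≡⟨ cong₂ (λ u v → ½ * u + ½ * v) (hit-rec₃ k (suc j)) (hit-rec₃ k j) ⟩
  0ℚ ∎
  where
  open ≡-Reasoning
  x₀ x₁ x₂ x₃ : ℚ
  x₀ = hit k (suc (suc j))
  x₁ = hit k (suc j)
  x₂ = hit k j
  x₃ = hit k (j ∸ 1)

hit-rec₂ : ∀ k m → rec₂ (ι m) (ι k) (hit k m) (hit k (m ∸ 1)) ≡ 0ℚ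
hit-rec₂ zero    zero          = refl
hit-rec₂ zero    (suc zero)    = refl
hit-rec₂ zero    (suc (suc j)) = rec₂-zero (ι (suc (suc j))) 0ℚ
hit-rec₂ (suc k) zero          = rec₂-zero 0ℚ (ι (suc k))
hit-rec₂ (suc k) (suc zero)    = begin
  rec₂ (1ℚ + 0ℚ) (1ℚ + ι k) (½ * (hit k 0 + hit k 0)) 0ℚ
    ≡⟨ solve 2 (λ K a → Syntax.rec₂ (con 1ℚ :+ con 0ℚ) (con 1ℚ :+ K) (con ½ :* (a :+ a)) (con 0ℚ)
                        := (con (# 3) :+ con (# 3) :* K) :* (K :* a)) refl (ι k) (hit k 0) ⟩
  (# 3 + # 3 * ι k) * (ι k * hit k 0)
    ≡⟨ cong ((# 3 + # 3 * ι k) *_) (hit-zero-target k) ⟩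
  (# 3 + # 3 * ι k) * 0ℚ
    ≡⟨ ℚP.*-zeroʳ (# 3 + # 3 * ι k) ⟩
  0ℚ ∎
  where open ≡-Reasoning
hit-rec₂ (suc k) (suc (suc j)) = begin
  rec₂ (ι (suc (suc j))) (1ℚ + ι k) (½ * (x₀ + x₁)) (½ * (x₁ + x₂))
    ≡⟨ solve 5 (λ J K x₀ x₁ x₂ → Syntax.rec₂ (con 1ℚ :+ (con 1ℚ :+ J)) (con 1ℚ :+ K) (con ½ :* (x₀ :+ x₁)) (con ½ :* (x₁ :+ x₂))
                := con ½ :* Syntax.rec₂ (con 1ℚ :+ J) K x₀ x₁ :+ con ½ :* Syntax.rec₂ J K x₁ x₂ :- con ½ :* Syntax.rec₃ J K x₀ x₁ x₂)
               refl (ι j) (ι k) x₀ x₁ x₂ ⟩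
  ½ * rec₂ (ι (suc j)) (ι k) x₀ x₁ + ½ * rec₂ (ι j) (ι k) x₁ x₂ - ½ * rec₃ (ι j) (ι k) x₀ x₁ x₂
    ≡⟨ cong₂ (λ u v → u - ½ * v) (cong₂ (λ u v → ½ * u + ½ * v) (hit-rec₂ k (suc j)) (hit-rec₂ k j)) (hit-rec₃ k j) ⟩
  0ℚ ∎
  where
  open ≡-Reasoning
  x₀ x₁ x₂ : ℚ
  x₀ = hit k (suc j)
  x₁ = hit k j
  x₂ = hit k (j ∸ 1)

plus-vanishing : ∀ X a b c d {t u v w} → t ≡ 0ℚ → u ≡ 0ℚ → v ≡ 0ℚ → w ≡ 0ℚ → X + (a * t + b * u + c * v) + d * w ≡ X
plus-vanishing X a b c d refl refl refl refl =
  solve 5 (λ X a b c d → X :+ (a :* con 0ℚ :+ b :* con 0ℚ :+ c :* con 0ℚ) :+ d :* con 0ℚ := X) refl X a b c d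

G-zero : ∀ N K → G N K 0ℚ 0ℚ 0ℚ ≡ 0ℚ
G-zero = solve 2 (λ N K → Syntax.G N K (con 0ℚ) (con 0ℚ) (con 0ℚ) := con 0ℚ) refl

isolate : ∀ D u w₁ w₂ w₃ w₄ c₀ c₁ c₂ c₃ c₄ e₀ e₁ e₂ e₃ e₄ → u * D ≡ 1ℚ →
          c₀ ≡ D → c₁ ≡ - (D * w₁) → c₂ ≡ - (D * w₂) → c₃ ≡ - (D * w₃) → c₄ ≡ D * w₄ →
          c₀ * e₀ + c₁ * e₁ + c₂ * e₂ + c₃ * e₃ + c₄ * e₄ ≡ 0ℚ →
          w₁ * e₁ + w₂ * e₂ + w₃ * e₃ - w₄ * e₄ ≡ e₀
isolate D u w₁ w₂ w₃ w₄ _ _ _ _ _ e₀ e₁ e₂ e₃ e₄ inverse refl refl refl refl refl relation = begin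
  L                                     ≡⟨ solve 11 (λ D u w₁ w₂ w₃ w₄ e₀ e₁ e₂ e₃ e₄ →
                                             let L = w₁ :* e₁ :+ w₂ :* e₂ :+ w₃ :* e₃ :- w₄ :* e₄ in
                                             L := e₀ :- u :* (D :* e₀ :+ (:- (D :* w₁)) :* e₁ :+ (:- (D :* w₂)) :* e₂
                                                              :+ (:- (D :* w₃)) :* e₃ :+ (D :* w₄) :* e₄)
                                                  :+ (con 1ℚ :- u :* D) :* (L :- e₀))
                                           refl D u w₁ w₂ w₃ w₄ e₀ e₁ e₂ e₃ e₄ ⟩
  e₀ - u * X + (1ℚ - u * D) * (L - e₀)  ≡⟨ cong₂ (λ x y → e₀ - u * x + (1ℚ - y) * (L - e₀)) relation inverse ⟩
  e₀ - u * 0ℚ + (1ℚ - 1ℚ) * (L - e₀)    ≡⟨ solve 3 (λ u e₀ L → e₀ :- u :* con 0ℚ :+ (con 1ℚ :- con 1ℚ) :* (L :- e₀) := e₀) refl u e₀ L ⟩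
  e₀                                    ∎
  where
  open ≡-Reasoning
  L X : ℚ
  L = w₁ * e₁ + w₂ * e₂ + w₃ * e₃ - w₄ * e₄
  X = D * e₀ + (- (D * w₁)) * e₁ + (- (D * w₂)) * e₂ + (- (D * w₃)) * e₃ + (D * w₄) * e₄

positive-product : ∀ a b → 0 < a → 0 < b → 0 < a ℕ.* b
positive-product (suc a) (suc b) _ _ = s≤s z≤n

-- The recurrence for tie n n at n = j + 5, with the targets n₀ = n, …, n₄ = n - 4.
module Recurrence (j : ℕ) where
  n₀ n₁ n₂ n₃ n₄ : ℕ
  n₄ = suc j
  n₃ = suc n₄
  n₂ = suc n₃
  n₁ = suc n₂
  n₀ = suc n₁

  N : ℚ
  N = ι n₀

  term : ℕ → ℚ
  term k = summand N (hit k n₀) (hit k n₁) (hit k n₂) (hit k n₃) (hit k n₄)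

  Gₖ : ℕ → ℚ
  Gₖ k = G N (ι k) (hit k n₀) (hit k n₁) (hit k n₂)

  -- The telescoping identity holds modulo the recurrences of hit, which vanish.
  term-telescopes : ∀ k → term k + Gₖ k ≡ Gₖ (suc k)
  term-telescopes k = trans (telescoping-identity (ι j) (ι k) x₀ x₁ x₂ x₃ x₄)
    (plus-vanishing (Gₖ (suc k)) (μ₀ N (ι k) x₀ x₁ x₂ x₃ x₄) (μ₁ N (ι k) x₀ x₁ x₂ x₃ x₄) (μ₂ N (ι k) x₀ x₁ x₂ x₃ x₄) (ν x₀ x₁ x₂ x₃ x₄)
                    (hit-rec₃ k n₁) (hit-rec₃ k n₂) (hit-rec₃ k n₃) (hit-rec₂ k n₀))
    where
    x₀ x₁ x₂ x₃ x₄ : ℚ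
    x₀ = hit k n₀
    x₁ = hit k n₁
    x₂ = hit k n₂
    x₃ = hit k n₃
    x₄ = hit k n₄

  -- Summed over k ≤ n₀ the terms telescope to G at n₀ + 1 minus G at 0, and
  -- both vanish: no target is hit at toss 0 or after toss n₀.
  term-sum : sumTo (suc n₀) term ≡ 0ℚ
  term-sum = begin
    sumTo (suc n₀) term                ≡⟨ sym (ℚP.+-identityʳ _) ⟩
    sumTo (suc n₀) term + 0ℚ           ≡⟨ cong (sumTo (suc n₀) term +_) (sym (G-zero N 0ℚ)) ⟩
    sumTo (suc n₀) term + Gₖ 0         ≡⟨ telescope term Gₖ term-telescopes (suc n₀) ⟩
    Gₖ (suc n₀)                        ≡⟨ cong₂ (λ x y → G N (ι (suc n₀)) x y (hit (suc n₀) n₂))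
                                            (hit-vanish (suc n₀) n₀ (ℕP.n<1+n n₀)) (hit-vanish (suc n₀) n₁ (ℕP.m≤n+m n₀ 1)) ⟩
    G N (ι (suc n₀)) 0ℚ 0ℚ (hit (suc n₀) n₂)
                                       ≡⟨ cong (G N (ι (suc n₀)) 0ℚ 0ℚ) (hit-vanish (suc n₀) n₂ (ℕP.m≤n+m n₁ 2)) ⟩
    G N (ι (suc n₀)) 0ℚ 0ℚ 0ℚ          ≡⟨ G-zero N (ι (suc n₀)) ⟩
    0ℚ                                 ∎
    where open ≡-Reasoning

  -- Splitting the sum into the five diagonals (each extended to n₀ + 1 terms).
  tie-recurrence : c₀ N * tie n₀ n₀ + c₁ N * tie n₁ n₁ + c₂ N * tie n₂ n₂ + c₃ N * tie n₃ n₃ + c₄ N * tie n₄ n₄ ≡ 0ℚ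
  tie-recurrence = begin
    c₀ N * tie n₀ n₀ + c₁ N * tie n₁ n₁ + c₂ N * tie n₂ n₂ + c₃ N * tie n₃ n₃ + c₄ N * tie n₄ n₄
      ≡⟨ sym (cong₂ (λ x y → c₀ N * x + c₁ N * y + c₂ N * tie n₂ n₂ + c₃ N * tie n₃ n₃ + c₄ N * tie n₄ n₄) (tie-extend n₀ n₀ 0) (tie-extend n₁ n₁ 1)) ⟩
    c₀ N * S n₀ + c₁ N * S n₁ + c₂ N * tie n₂ n₂ + c₃ N * tie n₃ n₃ + c₄ N * tie n₄ n₄
      ≡⟨ sym (cong₂ (λ x y → c₀ N * S n₀ + c₁ N * S n₁ + c₂ N * x + c₃ N * y + c₄ N * tie n₄ n₄) (tie-extend n₂ n₂ 2) (tie-extend n₃ n₃ 3)) ⟩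
    c₀ N * S n₀ + c₁ N * S n₁ + c₂ N * S n₂ + c₃ N * S n₃ + c₄ N * tie n₄ n₄
      ≡⟨ sym (cong (λ x → c₀ N * S n₀ + c₁ N * S n₁ + c₂ N * S n₂ + c₃ N * S n₃ + c₄ N * x) (tie-extend n₄ n₄ 4)) ⟩
    c₀ N * S n₀ + c₁ N * S n₁ + c₂ N * S n₂ + c₃ N * S n₃ + c₄ N * S n₄
      ≡⟨ sym (sumTo-linear₅ (suc n₀) (c₀ N) (c₁ N) (c₂ N) (c₃ N) (c₄ N) (sq n₀) (sq n₁) (sq n₂) (sq n₃) (sq n₄)) ⟩
    sumTo (suc n₀) term
      ≡⟨ term-sum ⟩
    0ℚ ∎
    where
    open ≡-Reasoning
    sq : ℕ → ℕ → ℚ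
    sq r k = hit k r * hit k r
    S : ℕ → ℚ
    S r = sumTo (suc n₀) (sq r)

  X d d₁ : ℕ
  X  = 3 ℕ.* n₀ ∸ 7
  d  = 16 ℕ.* n₀ ℕ.* X
  d₁ = 2 ℕ.* n₀ ℕ.* X

  w₁ w₂ w₃ w₄ : ℚ
  w₁ = ((3 ℕ.* n₀ ∸ 1) ℕ.* (n₀ ∸ 3)) /ℚ d₁
  w₂ = ((21 ℕ.* n₀ ℕ.* n₀ ℕ.+ 62) ∸ 67 ℕ.* n₀) /ℚ d
  w₃ = ((6 ℕ.* n₀ ℕ.* n₀ ℕ.+ 2) ∸ 17 ℕ.* n₀) /ℚ d
  w₄ = ((n₀ ∸ 4) ℕ.* (3 ℕ.* n₀ ∸ 4)) /ℚ d

  -- Size facts that keep the truncated subtractions exact (n₀ ≥ 5).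
  5≤n₀ : 5 ≤ n₀
  5≤n₀ = s≤s (s≤s (s≤s (s≤s (s≤s z≤n))))

  c≤3n₀ : ∀ c → c ≤ 15 → c ≤ 3 ℕ.* n₀
  c≤3n₀ c c≤15 = ℕP.≤-trans c≤15 (ℕP.*-monoʳ-≤ 3 5≤n₀)

  linear≤quadratic : ∀ a b e → a ≤ b ℕ.* 5 → a ℕ.* n₀ ≤ b ℕ.* n₀ ℕ.* n₀ ℕ.+ e
  linear≤quadratic a b e a≤5b = ℕP.≤-trans (ℕP.*-monoˡ-≤ n₀ (ℕP.≤-trans a≤5b (ℕP.*-monoʳ-≤ b 5≤n₀))) (ℕP.m≤m+n (b ℕ.* n₀ ℕ.* n₀) e)

  X-positive : 0 < X
  X-positive = ℕP.m<n⇒0<n∸m (c≤3n₀ 8 (ℕP.m≤m+n 8 7))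

  d-positive : 0 < d
  d-positive = positive-product (16 ℕ.* n₀) X (s≤s z≤n) X-positive

  ι-X : ι X ≡ # 3 * N - # 7
  ι-X = trans (ι-∸ (3 ℕ.* n₀) 7 (c≤3n₀ 7 (ℕP.m≤m+n 7 8))) (cong (_- ι 7) (ι-* 3 n₀))

  ι-d : ι d ≡ # 16 * N * (# 3 * N - # 7)
  ι-d = trans (ι-* (16 ℕ.* n₀) X) (cong₂ _*_ (ι-* 16 n₀) ι-X)

  ι-d₁ : ι d₁ ≡ # 2 * N * (# 3 * N - # 7)
  ι-d₁ = trans (ι-* (2 ℕ.* n₀) X) (cong₂ _*_ (ι-* 2 n₀) ι-X)

  d≡8d₁ : ι d ≡ # 8 * ι d₁
  d≡8d₁ = begin
    ι d                                   ≡⟨ ι-d ⟩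
    # 16 * N * (# 3 * N - # 7)            ≡⟨ solve 1 (λ N → con (# 16) :* N :* (con (# 3) :* N :- con (# 7))
                                                     := con (# 8) :* (con (# 2) :* N :* (con (# 3) :* N :- con (# 7)))) refl N ⟩
    # 8 * (# 2 * N * (# 3 * N - # 7))     ≡⟨ cong (# 8 *_) (sym ι-d₁) ⟩
    # 8 * ι d₁                            ∎
    where open ≡-Reasoning

  weight : ∀ x e → 0 < e → ι e * (x /ℚ e) ≡ ι x
  weight x e e>0 = trans (ℚP.*-comm (ι e) (x /ℚ e)) (/ℚ-*-ι x e e>0)

  c₀-coefficient : c₀ N ≡ ι d
  c₀-coefficient = sym ι-d

  c₁-coefficient : c₁ N ≡ - (ι d * w₁)
  c₁-coefficient = cong -_ (begin
    # 8 * ((# 3 * N - # 1) * (N - # 3))                ≡⟨ cong (# 8 *_) (cong₂ _*_ (sym (trans (ι-∸ (3 ℕ.* n₀) 1 (c≤3n₀ 1 (s≤s z≤n))) (cong (_- ι 1) (ι-* 3 n₀))))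
                                                                                    (sym (ι-∸ n₀ 3 (ℕP.≤-trans (ℕP.m≤m+n 3 2) 5≤n₀)))) ⟩
    # 8 * (ι (3 ℕ.* n₀ ∸ 1) * ι (n₀ ∸ 3))             ≡⟨ cong (# 8 *_) (sym (ι-* (3 ℕ.* n₀ ∸ 1) (n₀ ∸ 3))) ⟩
    # 8 * ι ((3 ℕ.* n₀ ∸ 1) ℕ.* (n₀ ∸ 3))             ≡⟨ cong (# 8 *_) (sym (weight _ d₁ (positive-product (2 ℕ.* n₀) X (s≤s z≤n) X-positive))) ⟩
    # 8 * (ι d₁ * w₁)                                 ≡⟨ sym (ℚP.*-assoc (# 8) (ι d₁) w₁) ⟩
    # 8 * ι d₁ * w₁                                   ≡⟨ cong (_* w₁) (sym d≡8d₁) ⟩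
    ι d * w₁                                          ∎)
    where open ≡-Reasoning

  quadratic-weight : ∀ p e q → q ≤ p ℕ.* 5 → ι p * N * N + ι e - ι q * N ≡ ι d * (((p ℕ.* n₀ ℕ.* n₀ ℕ.+ e) ∸ q ℕ.* n₀) /ℚ d)
  quadratic-weight p e q q≤5p = begin
    ι p * N * N + ι e - ι q * N                   ≡⟨ cong₂ _-_ (cong (_+ ι e) (cong (_* N) (sym (ι-* p n₀)))) (sym (ι-* q n₀)) ⟩
    ι (p ℕ.* n₀) * N + ι e - ι (q ℕ.* n₀)         ≡⟨ cong (λ x → x + ι e - ι (q ℕ.* n₀)) (sym (ι-* (p ℕ.* n₀) n₀)) ⟩
    ι (p ℕ.* n₀ ℕ.* n₀) + ι e - ι (q ℕ.* n₀)      ≡⟨ cong (_- ι (q ℕ.* n₀)) (sym (ι-+ (p ℕ.* n₀ ℕ.* n₀) e)) ⟩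
    ι (p ℕ.* n₀ ℕ.* n₀ ℕ.+ e) - ι (q ℕ.* n₀)      ≡⟨ sym (ι-∸ _ _ (linear≤quadratic q p e q≤5p)) ⟩
    ι ((p ℕ.* n₀ ℕ.* n₀ ℕ.+ e) ∸ q ℕ.* n₀)        ≡⟨ sym (weight _ d d-positive) ⟩
    ι d * (((p ℕ.* n₀ ℕ.* n₀ ℕ.+ e) ∸ q ℕ.* n₀) /ℚ d) ∎
    where open ≡-Reasoning

  c₂-coefficient : c₂ N ≡ - (ι d * w₂)
  c₂-coefficient = cong -_ (quadratic-weight 21 62 67 (ℕP.m≤m+n 67 38))

  c₃-coefficient : c₃ N ≡ - (ι d * w₃)
  c₃-coefficient = cong -_ (quadratic-weight 6 2 17 (ℕP.m≤m+n 17 13))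

  c₄-coefficient : c₄ N ≡ ι d * w₄
  c₄-coefficient = begin
    (N - # 4) * (# 3 * N - # 4)                   ≡⟨ cong₂ _*_ (sym (ι-∸ n₀ 4 (ℕP.≤-trans (ℕP.m≤m+n 4 1) 5≤n₀)))
                                                                 (sym (trans (ι-∸ (3 ℕ.* n₀) 4 (c≤3n₀ 4 (ℕP.m≤m+n 4 11))) (cong (_- ι 4) (ι-* 3 n₀)))) ⟩
    ι (n₀ ∸ 4) * ι (3 ℕ.* n₀ ∸ 4)                 ≡⟨ sym (ι-* (n₀ ∸ 4) (3 ℕ.* n₀ ∸ 4)) ⟩
    ι ((n₀ ∸ 4) ℕ.* (3 ℕ.* n₀ ∸ 4))               ≡⟨ sym (weight _ d d-positive) ⟩
    ι d * w₄                                      ∎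
    where open ≡-Reasoning

  tie-solved : w₁ * tie n₁ n₁ + w₂ * tie n₂ n₂ + w₃ * tie n₃ n₃ - w₄ * tie n₄ n₄ ≡ tie n₀ n₀
  tie-solved = isolate (ι d) (1 /ℚ d) w₁ w₂ w₃ w₄ (c₀ N) (c₁ N) (c₂ N) (c₃ N) (c₄ N)
                       (tie n₀ n₀) (tie n₁ n₁) (tie n₂ n₂) (tie n₃ n₃) (tie n₄ n₄)
                       (/ℚ-*-ι 1 d d-positive) c₀-coefficient c₁-coefficient c₂-coefficient c₃-coefficient c₄-coefficient
                       tie-recurrence

a≡tie : ∀ n → 1 ≤ n → a n ≡ tie n n
a≡tie zero                               ()
a≡tie (suc zero)                         _ = refl
a≡tie (suc (suc zero))                   _ = refl
a≡tie (suc (suc (suc zero)))             _ = refl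
a≡tie (suc (suc (suc (suc zero))))       _ = refl
a≡tie (suc (suc (suc (suc (suc j)))))    _ =
  trans (cong₂ _-_ (cong₂ _+_ (cong₂ _+_ (cong (w₁ *_) (a≡tie (suc (suc (suc (suc j)))) (s≤s z≤n)))
                                          (cong (w₂ *_) (a≡tie (suc (suc (suc j))) (s≤s z≤n))))
                              (cong (w₃ *_) (a≡tie (suc (suc j)) (s≤s z≤n))))
                   (cong (w₄ *_) (a≡tie (suc j) (s≤s z≤n))))
        tie-solved
  where open Recurrence j

halve : ∀ x y → x + x ≡ y → x ≡ ½ * y
halve x y x+x≡y = trans (solve 1 (λ x → x := con ½ :* (x :+ x)) refl x) (cong (½ *_) x+x≡y)

proposition4 : (n : ℕ) → 1 ≤ n → probFirstWins n ≡ ½ * (1ℚ + a n)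
proposition4 n 1≤n = begin
  probFirstWins n      ≡⟨ /ℚ-2^ (count (firstWins n) (allSeqs (2 ℕ.* n))) (2 ℕ.* n) ⟩
  V (2 ℕ.* n) 0 0      ≡⟨ halve (V (2 ℕ.* n) 0 0) _ (mover-advantage (2 ℕ.* n) 0 0 1≤n 1≤n (ℕP.≤-reflexive (two-n n))) ⟩
  ½ * (1ℚ + tie n n)   ≡⟨ cong (λ x → ½ * (1ℚ + x)) (sym (a≡tie n 1≤n)) ⟩
  ½ * (1ℚ + a n)       ∎
  where
  open ≡-Reasoning
  open Game n using (V; mover-advantage)
  -- 2n tosses decide the game from the start.
  two-n : ∀ n → n ℕ.+ n ≡ 2 ℕ.* n ℕ.+ (0 ℕ.+ 0)
  two-n = solve-∀
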